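{- Let $\mathfrak{X}$ and $\mathfrak{Y}$ be topological spaces with carriers $X$ and $Y$, and let $\mathbf{C}$ be the class of all continuous partial functions from $\mathfrak{X}$ to $\mathfrak{Y}$. Let $\mathcal{A}$ be a finite collection of subsets of $X$. If, for each subcollection $\mathcal{K}\subseteq\mathcal{A}$, some open set of $\mathfrak{X}$ separates $\bigcup\mathcal{K}\setminus\bigcup(\mathcal{A}\setminus\mathcal{K})$ from $\bigcup(\mathcal{A}\setminus\mathcal{K})\setminus\bigcup\mathcal{K}$, then $\mathcal{A}$ is strongly join permitting for $\mathbf{C}$. Moreover, if there exists an open set of $\mathfrak{Y}$ different from $\varnothing$ and $Y$, then the converse also holds.
   Context: Functions are considered as sets of ordered pairs; $f\!\upharpoonright_A$ denotes the restriction of $f$ to $A\cap\mathrm{dom}(f)$. A partial function $f$ from $X$ to $Y$ is continuous if for every open set $V$ of $\mathfrak{Y}$, $f^{ -1}(V)$ is the intersection of $\mathrm{dom}(f)$ with some open set of $\mathfrak{X}$. For a class $\mathbf{C}$ of functions, a collection $\mathcal{A}$ of sets is strongly join permitting for $\mathbf{C}$ if for every function $f$ with $\mathrm{dom}(f)\subseteq\bigcup\mathcal{A}$: if $f\!\upharpoonright_A\in\mathbf{C}$ for all $A\in\mathcal{A}$, then $f\in\mathbf{C}$. $\bigcup\mathcal{K}$ is the union of the members of $\mathcal{K}$ (empty if $\mathcal{K}=\varnothing$). A set $H$ separates $P$ from $Q$ if $H\supseteq P$ and $H\cap Q=\varnothing$. -}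

module Defs where

open import Level using (Level; suc; _⊔_)
open import Data.Product using (Σ; _×_; _,_)
open import Data.Fin using (Fin)
open import Data.Fin.Subset using (Subset; _∈_; _∉_)
open import Relation.Nullary using (¬_; Dec)
open import Relation.Binary.PropositionalEquality using (_≡_)

Sub : ∀ {ℓ} → Set ℓ → Set (suc ℓ)
Sub {ℓ} X = X → Set ℓ

_⊆_ : ∀ {ℓ} {X : Set ℓ} → Sub X → Sub X → Set ℓ
P ⊆ Q = ∀ x → P x → Q x

_≐_ : ∀ {ℓ} {X : Set ℓ} → Sub X → Sub X → Set ℓ
P ≐ Q = (P ⊆ Q) × (Q ⊆ P)

_∩_ : ∀ {ℓ} {X : Set ℓ} → Sub X → Sub X → Sub X
(P ∩ Q) x = P x × Q x

_∖_ : ∀ {ℓ} {X : Set ℓ} → Sub X → Sub X → Sub X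
(P ∖ Q) x = P x × ¬ Q x

∅ : ∀ {ℓ} {X : Set ℓ} → Sub X
∅ {ℓ} x = Level.Lift ℓ Data.Empty.⊥
  where import Data.Empty

Full : ∀ {ℓ} {X : Set ℓ} → Sub X
Full {ℓ} x = Level.Lift ℓ Data.Unit.⊤
  where import Data.Unit

record Top (ℓ : Level) : Set (suc ℓ) where
  field
    Carrier   : Set ℓ
    IsOpen    : Sub Carrier → Set ℓ
    open-ext  : ∀ {U V} → U ≐ V → IsOpen U → IsOpen V
    open-∅    : IsOpen ∅
    open-full : IsOpen Full
    open-∩    : ∀ {U V} → IsOpen U → IsOpen V → IsOpen (U ∩ V)
    open-⋃    : (I : Set ℓ) (U : I → Sub Carrier) → (∀ i → IsOpen (U i)) →
                IsOpen (λ x → Σ I λ i → U i x)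

open Top public

-- A partial function from X to Y, as a set of ordered pairs (a relation)
-- which is functional.
record PFun {ℓ} (X Y : Set ℓ) : Set (suc ℓ) where
  field
    graph      : X → Y → Set ℓ
    functional : ∀ {x y y'} → graph x y → graph x y' → y ≡ y'

open PFun public

dom : ∀ {ℓ} {X Y : Set ℓ} → PFun X Y → Sub X
dom f x = Σ _ λ y → graph f x y

preimage : ∀ {ℓ} {X Y : Set ℓ} → PFun X Y → Sub Y → Sub X
preimage f V x = Σ _ λ y → graph f x y × V y

restrict : ∀ {ℓ} {X Y : Set ℓ} → PFun X Y → Sub X → PFun X Y
graph (restrict f A) x y = A x × graph f x y
functional (restrict f A) (_ , p) (_ , q) = functional f p q

Continuous : ∀ {ℓ} (𝔛 𝔜 : Top ℓ) → PFun (Carrier 𝔛) (Carrier 𝔜) → Set (suc ℓ)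
Continuous 𝔛 𝔜 f =
  ∀ (V : Sub (Carrier 𝔜)) → IsOpen 𝔜 V →
    Σ (Sub (Carrier 𝔛)) λ U → IsOpen 𝔛 U × (preimage f V ≐ (U ∩ dom f))

-- Finite collections 𝒜 of subsets of X are given as families Fin n → Sub X;
-- a subcollection 𝒦 ⊆ 𝒜 is given by a Subset n of indices.
⋃ : ∀ {ℓ} {X : Set ℓ} {n} → (Fin n → Sub X) → Subset n → Sub X
⋃ A K x = Σ _ λ i → (i ∈ K) × A i x

⋃co : ∀ {ℓ} {X : Set ℓ} {n} → (Fin n → Sub X) → Subset n → Sub X
⋃co A K x = Σ _ λ i → (i ∉ K) × A i x

⋃all : ∀ {ℓ} {X : Set ℓ} {n} → (Fin n → Sub X) → Sub X
⋃all A x = Σ _ λ i → A i x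

Separates : ∀ {ℓ} {X : Set ℓ} → Sub X → Sub X → Sub X → Set ℓ
Separates H P Q = (P ⊆ H) × (∀ x → H x → Q x → Data.Empty.⊥)
  where import Data.Empty

SeparationCondition : ∀ {ℓ} (𝔛 : Top ℓ) {n} → (Fin n → Sub (Carrier 𝔛)) → Set (suc ℓ)
SeparationCondition 𝔛 A =
  ∀ (K : Subset _) → Σ (Sub (Carrier 𝔛)) λ H →
    IsOpen 𝔛 H × Separates H (⋃ A K ∖ ⋃co A K) (⋃co A K ∖ ⋃ A K)

StronglyJoinPermitting : ∀ {ℓ} (𝔛 𝔜 : Top ℓ) {n} → (Fin n → Sub (Carrier 𝔛)) → Set (suc ℓ)
StronglyJoinPermitting 𝔛 𝔜 A =
  ∀ (f : PFun (Carrier 𝔛) (Carrier 𝔜)) → dom f ⊆ ⋃all A →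
    (∀ i → Continuous 𝔛 𝔜 (restrict f (A i))) → Continuous 𝔛 𝔜 f

HasNontrivialOpen : ∀ {ℓ} (𝔜 : Top ℓ) → Set (suc ℓ)
HasNontrivialOpen 𝔜 =
  Σ (Sub (Carrier 𝔜)) λ V → IsOpen 𝔜 V × ¬ (V ≐ ∅) × ¬ (V ≐ Full)

ExcludedMiddle : (ℓ : Level) → Set (suc ℓ)
ExcludedMiddle ℓ = (P : Set ℓ) → Dec P

-- Let Vᵢ be open with (f↾Aᵢ)⁻¹(V) = Vᵢ ∩ dom(f↾Aᵢ), classify a point by the subcollection 𝒦
-- of members of 𝒜 containing it, and glue U = ⋃_𝒦 (H_𝒦 ∩ ⋂_{i∈𝒦} Vᵢ) with H_𝒦 the separating
-- open set for 𝒦. A point x of dom f lies in the H_𝒦 of its own class, and whenever x ∈ H_𝒦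
-- the separation forces x ∈ Aᵢ for some i ∈ 𝒦; hence f⁻¹(V) = U ∩ dom f. Conversely, with an
-- open V ∉ {∅, Y} choose a ∈ V and b ∉ V, and let f be a on ⋃𝒦 ∖ ⋃(𝒜∖𝒦) and b on
-- ⋃(𝒜∖𝒦) ∖ ⋃𝒦. Every f↾Aᵢ is constant, hence continuous, so f is continuous and any open U
-- with f⁻¹(V) = U ∩ dom f separates the two sets.
module Submission where

open import Defs
open import Level using (Level; Lift; lift; lower)
open import Data.Nat using (ℕ; zero; suc)
open import Data.Fin using (Fin; zero; suc)
open import Data.Fin.Subset using (Subset; _∈_)
open import Data.Fin.Subset.Properties using (_∈?_)
open import Data.Vec using (tabulate)
open import Data.Vec.Properties using (lookup∘tabulate; lookup⇒[]=; []=⇒lookup)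
open import Data.Product using (Σ; _×_; _,_; proj₁; proj₂)
open import Data.Sum using (_⊎_; inj₁; inj₂)
open import Data.Empty using (⊥; ⊥-elim)
open import Function using (_∘_)
open import Relation.Nullary using (¬_; Dec; yes; no; does)
open import Relation.Nullary.Decidable using (dec-true)
open import Relation.Binary.PropositionalEquality using (_≡_; refl; sym; trans; subst)

selection : ∀ {n p} {P : Fin n → Set p} → (∀ i → Dec (P i)) → Subset n
selection P? = tabulate (λ i → does (P? i))

module _ {n p} {P : Fin n → Set p} (P? : ∀ i → Dec (P i)) where

  ∈-selection⁺ : ∀ {i} → P i → i ∈ selection P?
  ∈-selection⁺ {i} Pi = lookup⇒[]= i _ (trans (lookup∘tabulate _ i) (dec-true (P? i) Pi))

  ∈-selection⁻ : ∀ {i} → i ∈ selection P? → P i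
  ∈-selection⁻ {i} i∈ with P? i | trans (sym (lookup∘tabulate _ i)) ([]=⇒lookup i∈)
  ... | yes Pi | _ = Pi
  ... | no _   | ()

module _ {ℓ} (𝔛 : Top ℓ) where

  open-→ : ∀ {P : Set} {U : Sub (Carrier 𝔛)} → Dec P → IsOpen 𝔛 U → IsOpen 𝔛 (λ x → P → U x)
  open-→ (yes p) oU = open-ext 𝔛 ((λ _ u _ → u) , (λ _ h → h p)) oU
  open-→ (no ¬p) _  = open-ext 𝔛 ((λ _ _ p → ⊥-elim (¬p p)) , (λ _ _ → lift _)) (open-full 𝔛)

  open-Π : ∀ {n} (U : Fin n → Sub (Carrier 𝔛)) → (∀ i → IsOpen 𝔛 (U i)) →
           IsOpen 𝔛 (λ x → ∀ i → U i x)
  open-Π {zero}  U oU = open-ext 𝔛 ((λ _ _ ()) , (λ _ _ → lift _)) (open-full 𝔛)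
  open-Π {suc n} U oU =
    open-ext 𝔛 ((λ { _ (u₀ , u) zero → u₀ ; _ (u₀ , u) (suc i) → u i })
               , (λ _ u → u zero , u ∘ suc))
      (open-∩ 𝔛 (oU zero) (open-Π (U ∘ suc) (oU ∘ suc)))

⋂ : ∀ {ℓ} {X : Set ℓ} {n} → (Fin n → Sub X) → Subset n → Sub X
⋂ U K x = ∀ i → i ∈ K → U i x

open-⋂ : ∀ {ℓ} (𝔛 : Top ℓ) {n} (U : Fin n → Sub (Carrier 𝔛)) (K : Subset n) →
         (∀ i → IsOpen 𝔛 (U i)) → IsOpen 𝔛 (⋂ U K)
open-⋂ 𝔛 U K oU = open-Π 𝔛 (λ i x → i ∈ K → U i x) (λ i → open-→ 𝔛 (i ∈? K) (oU i))

module _ {ℓ} {X Y : Set ℓ} (f : PFun X Y) (A : Sub X) (V : Sub Y) where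

  restrict-preimage⁺ : ∀ {x} → A x → preimage f V x → preimage (restrict f A) V x
  restrict-preimage⁺ a (y , g , v) = y , (a , g) , v

  restrict-preimage⁻ : preimage (restrict f A) V ⊆ preimage f V
  restrict-preimage⁻ _ (y , (_ , g) , v) = y , g , v

module _ {ℓ} {X : Set ℓ} {n} (A : Fin n → Sub X) where

  ⋃all∖⋃⇒⋃co∖⋃ : ∀ {x} (K : Subset n) → ⋃all A x → ¬ ⋃ A K x → (⋃co A K ∖ ⋃ A K) x
  ⋃all∖⋃⇒⋃co∖⋃ K (i , a) ∉⋃ = (i , (λ i∈K → ∉⋃ (i , i∈K , a)) , a) , ∉⋃

  module _ (lem : ExcludedMiddle ℓ) where

    membership : X → Subset n
    membership x = selection (λ i → lem (A i x))

    ∈-membership⁺ : ∀ {x i} → A i x → i ∈ membership x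
    ∈-membership⁺ {x} = ∈-selection⁺ (λ i → lem (A i x))

    ∈-membership⁻ : ∀ {x i} → i ∈ membership x → A i x
    ∈-membership⁻ {x} = ∈-selection⁻ (λ i → lem (A i x))

    ⋃-membership : ∀ {x} → ⋃all A x → (⋃ A (membership x) ∖ ⋃co A (membership x)) x
    ⋃-membership (i , a) = (i , ∈-membership⁺ a , a) , λ (j , j∉ , aj) → j∉ (∈-membership⁺ aj)

separation⇒stronglyJoinPermitting : ∀ {ℓ} → ExcludedMiddle ℓ → (𝔛 𝔜 : Top ℓ) {n : ℕ}
  (A : Fin n → Sub (Carrier 𝔛)) → SeparationCondition 𝔛 A → StronglyJoinPermitting 𝔛 𝔜 A
separation⇒stronglyJoinPermitting {ℓ} lem 𝔛 𝔜 {n} A sep f dom⊆ cont V oV =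
  U , oU , preimage⊆ , ⊆preimage
  where
  Vᵢ : Fin n → Sub (Carrier 𝔛)
  Vᵢ i = proj₁ (cont i V oV)

  oVᵢ : ∀ i → IsOpen 𝔛 (Vᵢ i)
  oVᵢ i = proj₁ (proj₂ (cont i V oV))

  preimageᵢ⊆ : ∀ i → preimage (restrict f (A i)) V ⊆ (Vᵢ i ∩ dom (restrict f (A i)))
  preimageᵢ⊆ i = proj₁ (proj₂ (proj₂ (cont i V oV)))

  ⊆preimageᵢ : ∀ i → (Vᵢ i ∩ dom (restrict f (A i))) ⊆ preimage (restrict f (A i)) V
  ⊆preimageᵢ i = proj₂ (proj₂ (proj₂ (cont i V oV)))

  H : Subset n → Sub (Carrier 𝔛)
  H K = proj₁ (sep K)

  oH : ∀ K → IsOpen 𝔛 (H K)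
  oH K = proj₁ (proj₂ (sep K))

  H-separates : ∀ K → Separates (H K) (⋃ A K ∖ ⋃co A K) (⋃co A K ∖ ⋃ A K)
  H-separates K = proj₂ (proj₂ (sep K))

  U : Sub (Carrier 𝔛)
  U x = Σ (Lift ℓ (Subset n)) λ K → (H (lower K) ∩ ⋂ Vᵢ (lower K)) x

  oU : IsOpen 𝔛 U
  oU = open-⋃ 𝔛 _ _ λ K → open-∩ 𝔛 (oH (lower K)) (open-⋂ 𝔛 Vᵢ (lower K) oVᵢ)

  preimage⊆ : preimage f V ⊆ (U ∩ dom f)
  preimage⊆ x fx∈V@(y , g , _) = (lift K , x∈H , x∈⋂) , (y , g)
    where
    K = membership A lem x

    x∈H : H K x
    x∈H = proj₁ (H-separates K) x (⋃-membership A lem (dom⊆ x (y , g)))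

    x∈⋂ : ⋂ Vᵢ K x
    x∈⋂ i i∈K =
      proj₁ (preimageᵢ⊆ i x (restrict-preimage⁺ f (A i) V (∈-membership⁻ A lem i∈K) fx∈V))

  ⊆preimage : (U ∩ dom f) ⊆ preimage f V
  ⊆preimage x ((lift K , x∈H , x∈⋂) , x∈dom@(y , g)) with lem (⋃ A K x)
  ... | yes (i , i∈K , a) = restrict-preimage⁻ f (A i) V x (⊆preimageᵢ i x (x∈⋂ i i∈K , y , a , g))
  ... | no ∉⋃ = ⊥-elim (proj₂ (H-separates K) x x∈H (⋃all∖⋃⇒⋃co∖⋃ A K (dom⊆ x x∈dom) ∉⋃))

constant-continuous : ∀ {ℓ} → ExcludedMiddle ℓ → (𝔛 𝔜 : Top ℓ)
  (g : PFun (Carrier 𝔛) (Carrier 𝔜)) (c : Carrier 𝔜) →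
  (∀ {x y} → graph g x y → y ≡ c) → Continuous 𝔛 𝔜 g
constant-continuous lem 𝔛 𝔜 g c const V oV with lem (V c)
... | yes c∈V = Full , open-full 𝔛 , (λ _ (y , gy , _) → lift _ , y , gy)
                                   , (λ _ (_ , y , gy) → y , gy , subst V (sym (const gy)) c∈V)
... | no c∉V  = ∅ , open-∅ 𝔛 , (λ _ (_ , gy , vy) → ⊥-elim (c∉V (subst V (const gy) vy)))
                             , (λ _ (l , _) → ⊥-elim (lower l))

nontrivial-open⇒points : ∀ {ℓ} → ExcludedMiddle ℓ → (𝔜 : Top ℓ) → HasNontrivialOpen 𝔜 →
  Σ (Sub (Carrier 𝔜)) λ V → IsOpen 𝔜 V × Σ (Carrier 𝔜) V × Σ (Carrier 𝔜) (¬_ ∘ V)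
nontrivial-open⇒points lem 𝔜 (V , oV , V≠∅ , V≠Y) = V , oV , inside , outside
  where
  inside : Σ (Carrier 𝔜) V
  inside with lem (Σ (Carrier 𝔜) V)
  ... | yes a = a
  ... | no ¬a = ⊥-elim (V≠∅ ((λ y v → ⊥-elim (¬a (y , v))) , (λ _ l → ⊥-elim (lower l))))

  outside : Σ (Carrier 𝔜) (¬_ ∘ V)
  outside with lem (Σ (Carrier 𝔜) (¬_ ∘ V))
  ... | yes b = b
  ... | no ¬b = ⊥-elim (V≠Y ((λ _ _ → lift _) , λ y _ → everywhere y))
    where
    everywhere : ∀ y → V y
    everywhere y with lem (V y)
    ... | yes v = v
    ... | no ¬v = ⊥-elim (¬b (y , ¬v))

twoValued : ∀ {ℓ} {X Y : Set ℓ} (P Q : Sub X) → (∀ x → P x → Q x → ⊥) → Y → Y → PFun X Y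
graph (twoValued P Q _ a b) x y = (P x × y ≡ a) ⊎ (Q x × y ≡ b)
functional (twoValued P Q P∩Q=∅ a b) = λ where
  (inj₁ (_ , refl)) (inj₁ (_ , refl)) → refl
  (inj₂ (_ , refl)) (inj₂ (_ , refl)) → refl
  (inj₁ (p , _))    (inj₂ (q , _))    → ⊥-elim (P∩Q=∅ _ p q)
  (inj₂ (q , _))    (inj₁ (p , _))    → ⊥-elim (P∩Q=∅ _ p q)

open-in-out⇒separation : ∀ {ℓ} → ExcludedMiddle ℓ → (𝔛 𝔜 : Top ℓ) {n : ℕ}
  (A : Fin n → Sub (Carrier 𝔛)) {V : Sub (Carrier 𝔜)} {a b : Carrier 𝔜} →
  IsOpen 𝔜 V → V a → ¬ V b → StronglyJoinPermitting 𝔛 𝔜 A → SeparationCondition 𝔛 A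
open-in-out⇒separation lem 𝔛 𝔜 A {V} {a} {b} oV a∈V b∉V sjp K =
  separating (sjp f dom⊆ restrict-continuous V oV)
  where
  P = ⋃ A K ∖ ⋃co A K
  Q = ⋃co A K ∖ ⋃ A K

  f : PFun (Carrier 𝔛) (Carrier 𝔜)
  f = twoValued P Q (λ _ p q → proj₂ p (proj₁ q)) a b

  dom⊆ : dom f ⊆ ⋃all A
  dom⊆ _ (_ , inj₁ (((i , _ , x∈Aᵢ) , _) , _)) = i , x∈Aᵢ
  dom⊆ _ (_ , inj₂ (((i , _ , x∈Aᵢ) , _) , _)) = i , x∈Aᵢ

  restrict-continuous : ∀ i → Continuous 𝔛 𝔜 (restrict f (A i))
  restrict-continuous i with i ∈? K
  ... | yes i∈K = constant-continuous lem 𝔛 𝔜 (restrict f (A i)) a λ where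
    (_ , inj₁ (_ , y≡a))         → y≡a
    (x∈Aᵢ , inj₂ ((_ , ∉⋃) , _)) → ⊥-elim (∉⋃ (i , i∈K , x∈Aᵢ))
  ... | no i∉K = constant-continuous lem 𝔛 𝔜 (restrict f (A i)) b λ where
    (x∈Aᵢ , inj₁ ((_ , ∉⋃co) , _)) → ⊥-elim (∉⋃co (i , i∉K , x∈Aᵢ))
    (_ , inj₂ (_ , y≡b))           → y≡b

  separating : Σ (Sub (Carrier 𝔛)) (λ U → IsOpen 𝔛 U × (preimage f V ≐ (U ∩ dom f))) →
               Σ (Sub (Carrier 𝔛)) λ U → IsOpen 𝔛 U × Separates U P Q
  separating (U , oU , preimage⊆ , ⊆preimage) = U , oU , P⊆U , U∩Q=∅
    where
    P⊆U : P ⊆ U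
    P⊆U x p = proj₁ (preimage⊆ x (a , inj₁ (p , refl) , a∈V))

    U∩Q=∅ : ∀ x → U x → Q x → ⊥
    U∩Q=∅ x u q with ⊆preimage x (u , b , inj₂ (q , refl))
    ... | _ , inj₁ (p , _)    , _   = proj₂ p (proj₁ q)
    ... | _ , inj₂ (_ , refl) , b∈V = b∉V b∈V

theorem3p1 : ∀ {ℓ : Level} → ExcludedMiddle ℓ →
    (𝔛 𝔜 : Top ℓ) (n : ℕ) (A : Fin n → Sub (Carrier 𝔛)) →
    (SeparationCondition 𝔛 A → StronglyJoinPermitting 𝔛 𝔜 A) ×
    (HasNontrivialOpen 𝔜 → StronglyJoinPermitting 𝔛 𝔜 A → SeparationCondition 𝔛 A)
theorem3p1 lem 𝔛 𝔜 n A = separation⇒stronglyJoinPermitting lem 𝔛 𝔜 A , converse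
  where
  converse : HasNontrivialOpen 𝔜 → StronglyJoinPermitting 𝔛 𝔜 A → SeparationCondition 𝔛 A
  converse nontrivial with nontrivial-open⇒points lem 𝔜 nontrivial
  ... | _ , oV , (_ , a∈V) , (_ , b∉V) = open-in-out⇒separation lem 𝔛 𝔜 A oV a∈V b∉V
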